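{- For every $n\ge 1$, every periodic orbit of the map $s_{\{123,132\}}:S_n\to S_n$ has size $\left\lceil\frac{n+1}{2}\right\rceil$.
   Context: A point $a$ is periodic for $f:A\to A$ if $f^k(a)=a$ for some integer $k>0$; a periodic orbit is the orbit of a periodic point. A sequence of distinct integers contains a permutation $\tau$ if some subsequence is order-isomorphic to $\tau$; otherwise it avoids $\tau$. For a set $T$ of permutations, the map $s_T$ is defined by: read the input permutation left to right with an initially empty stack and output; at each step, if there is a next input element and pushing it keeps the stack contents, read from top to bottom, $T$-avoiding, push it; otherwise pop the top of the stack and append it to the output; stop when input and stack are empty; the output is $s_T(\pi)$. -}

module Defs where

open import Data.Nat using (ℕ; zero; suc; _+_; _*_; _<ᵇ_)
open import Data.Bool using (Bool; true; false; _∧_; _∨_; not; if_then_else_)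
open import Data.List using (List; []; _∷_; _++_; [_]; length; map; upTo; concatMap; zip)
open import Data.Bool.ListAction using (any; all)
open import Data.Product using (_×_; _,_)

-- Permutations are lists of distinct naturals; a permutation of [n] = {1..n}
-- is a list that is a rearrangement of 1,2,...,n.
oneTo : ℕ → List ℕ
oneTo n = map suc (upTo n)

subseqs : List ℕ → List (List ℕ)
subseqs [] = [] ∷ []
subseqs (x ∷ xs) = let r = subseqs xs in map (x ∷_) r ++ r

pairs : List ℕ → List (ℕ × ℕ)
pairs [] = []
pairs (x ∷ xs) = map (x ,_) xs ++ pairs xs

_≡ᵇlen_ : List ℕ → List ℕ → Bool
[] ≡ᵇlen [] = true
(_ ∷ xs) ≡ᵇlen (_ ∷ ys) = xs ≡ᵇlen ys
_ ≡ᵇlen _ = false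

orderIso : List ℕ → List ℕ → Bool
orderIso xs τ = (xs ≡ᵇlen τ) ∧
  all (λ { ((a , b) , (c , d)) → not ((a <ᵇ b) ∧ not (c <ᵇ d)) ∧ not (not (a <ᵇ b) ∧ (c <ᵇ d)) })
      (zip (pairs xs) (pairs τ))

contains : List ℕ → List ℕ → Bool
contains σ τ = any (λ s → orderIso s τ) (subseqs σ)

avoidsAll : List (List ℕ) → List ℕ → Bool
avoidsAll T σ = all (λ τ → not (contains σ τ)) T

-- One run of the T-stack-sorting machine, with fuel.
-- State: input, stack (head = top), output so far.
-- Each element is pushed once and popped once, so 2·(length input) steps suffice.
run : List (List ℕ) → ℕ → List ℕ → List ℕ → List ℕ → List ℕ
run T zero inp st out = out
run T (suc k) [] [] out = out
run T (suc k) (x ∷ inp) [] out =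
  run T k inp (x ∷ []) out
run T (suc k) [] (y ∷ st) out = run T k [] st (out ++ [ y ])
run T (suc k) (x ∷ inp) (y ∷ st) out =
  if avoidsAll T (x ∷ y ∷ st)
  then run T k inp (x ∷ y ∷ st) out
  else run T k (x ∷ inp) st (out ++ [ y ])

sT : List (List ℕ) → List ℕ → List ℕ
sT T π = run T (2 * length π) π [] []

T123-132 : List (List ℕ)
T123-132 = (1 ∷ 2 ∷ 3 ∷ []) ∷ (1 ∷ 3 ∷ 2 ∷ []) ∷ []

iter : {A : Set} → (A → A) → ℕ → A → A
iter f zero a = a
iter f (suc k) a = f (iter f k a)

-- A stack avoids 123 and 132 iff no entry has two larger entries below it. Say π has shape (i, k)
-- if π = P ++ i ∷ g₁ ∷ (i ∸ 1) ∷ g₂ ∷ … ∷ 1 ∷ gᵢ with |P| = k + 1 and every entry of the core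
-- P ++ g larger than i. In one pass the head p of P stays at the bottom of the stack while the rest
-- of P is processed, and each of i, …, 1 then flushes the stack down to p; the result has the same
-- shape, its core being front ++ g ++ [ p ] where stackSort P = front ++ [ p ]. Each pass moves the
-- value i + 1 one place towards the front of the core (from the head of P it goes to the end)
-- until it lies in P behind the head; the next pass emits it just before p, giving shape
-- (i + 1, k ∸ 2). So every orbit reaches a shape with k ≤ 1, where front is the tail of P and a
-- pass rotates the core. The core has distinct entries, so that orbit has exactly
-- |core| = k + 1 + i elements, which is ⌈(n + 1)/2⌉ for n = k + 1 + 2i. A periodic π lies on its
-- own orbit, so it already has such a shape.

module Submission where

open import Defs
open import Algebra.Bundles using (CommutativeMonoid)
open import Data.Bool using (Bool; true; false; _∧_; _∨_; not; if_then_else_; T)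
open import Data.Bool.ListAction using (any; or)
open import Data.Bool.Properties
  using (∨-assoc; ∨-zeroʳ; ∧-identityʳ; ∧-zeroʳ; T-≡; ∨-commutativeMonoid)
open import Algebra.Properties.CommutativeSemigroup
  (CommutativeMonoid.commutativeSemigroup ∨-commutativeMonoid) using (interchange)
open import Data.Empty using (⊥-elim)
open import Data.List
  using (List; []; _∷_; _++_; [_]; length; map; null; take; drop; head; applyUpTo; upTo)
open import Data.List.Properties
  using ( map-∘; map-cong; ++-assoc; ++-identityʳ; length-++; ∷-injective; ∷ʳ-injectiveˡ
        ; take++drop≡id; length-take; length-applyUpTo; length-map; length-upTo)
open import Data.List.Membership.Propositional using (_∈_)
open import Data.List.Membership.Propositional.Properties
  using (∈-++⁻; ∈-∃++; ∈-applyUpTo⁺; ∈-applyUpTo⁻)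
open import Data.List.Relation.Binary.Permutation.Propositional
  using (_↭_; ↭-refl; ↭-sym; ↭-trans; ↭-reflexive; swap; ↭⇒↭ₛ; module PermutationReasoning)
open import Data.List.Relation.Binary.Permutation.Propositional.Properties
  using (++⁺ˡ; ++⁺ʳ; shift; drop-∷; ↭-length; All-resp-↭; ∈-resp-↭; ++-comm)
open import Data.List.Relation.Unary.All using (All; []; _∷_)
import Data.List.Relation.Unary.All as All
open import Data.List.Relation.Unary.All.Properties using (++⁻ˡ; ++⁻ʳ)
import Data.List.Relation.Unary.All.Properties as All
open import Data.List.Relation.Unary.AllPairs using (_∷_)
open import Data.List.Relation.Unary.Any using (here; there)
open import Data.List.Relation.Unary.Unique.Propositional using (Unique; [])
open import Data.List.Relation.Unary.Unique.Propositional.Properties using (applyUpTo⁺₁)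
open import Data.Maybe using (just)
open import Data.Maybe.Properties using (just-injective)
open import Data.Nat
  using (ℕ; zero; suc; _+_; _*_; _<ᵇ_; _≤_; _<_; _≥_; _>_; z≤n; s≤s; _≟_; ⌈_/2⌉)
open import Data.Nat.Properties
  using ( <ᵇ⇒<; <⇒<ᵇ; <-asym; <-trans; n<1+n; <⇒≢; <⇒≤; ≤∧≢⇒<; ≤-pred; ≤-reflexive
        ; m≤n⇒m⊓n≡m; suc-injective; +-comm; +-suc; +-identityʳ; *-suc)
open import Data.Product using (_×_; _,_; uncurry; ∃; ∃₂; proj₁; proj₂)
import Data.Product as Product
open import Data.Sum using (inj₁; inj₂)
open import Data.Unit using (⊤)
open import Function using (_∘_; Equivalence; _⇔_; mk⇔)
open import Relation.Binary.PropositionalEquality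
  using (_≡_; _≢_; refl; sym; trans; cong; cong₂; subst; module ≡-Reasoning)
import Relation.Binary.PropositionalEquality as ≡
open import Data.List.Relation.Binary.Permutation.Setoid.Properties (≡.setoid ℕ) using (Unique-resp-↭)
open import Relation.Nullary using (yes; no)

private variable A : Set

any-++ : ∀ (p : A → Bool) xs ys → any p (xs ++ ys) ≡ any p xs ∨ any p ys
any-++ p [] ys = refl
any-++ p (x ∷ xs) ys = trans (cong (p x ∨_) (any-++ p xs ys)) (sym (∨-assoc (p x) _ _))

any-map : ∀ {B : Set} (p : B → Bool) (f : A → B) xs → any p (map f xs) ≡ any (p ∘ f) xs
any-map p f xs = cong or (sym (map-∘ xs))

any-cong : ∀ {p q : A → Bool} → (∀ x → p x ≡ q x) → ∀ xs → any p xs ≡ any q xs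
any-cong p≗q xs = cong or (map-cong p≗q xs)

any-const-∧ : ∀ b (p : A → Bool) xs → any (λ x → b ∧ p x) xs ≡ b ∧ any p xs
any-const-∧ true p xs = refl
any-const-∧ false p [] = refl
any-const-∧ false p (x ∷ xs) = any-const-∧ false p xs

any-∨ : ∀ (p q : A → Bool) xs → any (λ x → p x ∨ q x) xs ≡ any p xs ∨ any q xs
any-∨ p q [] = refl
any-∨ p q (x ∷ xs) =
  trans (cong ((p x ∨ q x) ∨_) (any-∨ p q xs)) (interchange (p x) (q x) (any p xs) (any q xs))

length-∷ʳ : ∀ (xs : List A) {y} → length (xs ++ [ y ]) ≡ suc (length xs)
length-∷ʳ xs = trans (length-++ xs) (+-comm (length xs) 1)

length-∷ʳ-↭ : ∀ (xs : List A) {y z zs} → xs ++ [ y ] ↭ z ∷ zs → length xs ≡ length zs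
length-∷ʳ-↭ xs xs∷ʳy↭ = suc-injective (trans (sym (length-∷ʳ xs)) (↭-length xs∷ʳy↭))

length-take-1-∷ʳ : ∀ (xs : List A) {y} → length (take 1 (xs ++ [ y ])) ≡ 1
length-take-1-∷ʳ [] = refl
length-take-1-∷ʳ (_ ∷ _) = refl

length-drop-1-∷ʳ : ∀ (xs : List A) {y} → length (drop 1 (xs ++ [ y ])) ≡ length xs
length-drop-1-∷ʳ [] = refl
length-drop-1-∷ʳ (_ ∷ xs) = length-∷ʳ xs

take-length-++ : ∀ (xs ys : List A) → take (length xs) (xs ++ ys) ≡ xs
take-length-++ [] ys = refl
take-length-++ (x ∷ xs) ys = cong (x ∷_) (take-length-++ xs ys)

++-cancel-length : ∀ (xs ys : List A) {zs ws} → length xs ≡ length ys → xs ++ zs ≡ ys ++ ws →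
  xs ≡ ys × zs ≡ ws
++-cancel-length [] [] _ eq = refl , eq
++-cancel-length (x ∷ xs) (y ∷ ys) |xs| eq with ∷-injective eq
... | refl , eq′ = Product.map₁ (cong (x ∷_)) (++-cancel-length xs ys (suc-injective |xs|) eq′)

drop-< : ∀ t (xs : List A) → t < length xs → ∃₂ λ y ys → drop t xs ≡ y ∷ ys
drop-< zero (x ∷ xs) _ = x , xs , refl
drop-< (suc t) (x ∷ xs) (s≤s t<) = drop-< t xs t<

rot : List A → List A
rot [] = []
rot (x ∷ xs) = xs ++ [ x ]

iter-suc-inner : ∀ (f : A → A) t x → iter f t (f x) ≡ iter f (suc t) x
iter-suc-inner f zero x = refl
iter-suc-inner f (suc t) x = cong f (iter-suc-inner f t x)

iter-+ : ∀ (f : A → A) a b x → iter f a (iter f b x) ≡ iter f (a + b) x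
iter-+ f zero b x = refl
iter-+ f (suc a) b x = cong f (iter-+ f a b x)

iter-cong : ∀ {f g : A → A} → (∀ x → f x ≡ g x) → ∀ t x → iter f t x ≡ iter g t x
iter-cong f≗g zero x = refl
iter-cong {g = g} f≗g (suc t) x = trans (f≗g _) (cong g (iter-cong f≗g t x))

iter-multiple : ∀ (f : A → A) {x} k → iter f (suc k) x ≡ x → ∀ c → iter f (c * suc k) x ≡ x
iter-multiple f k per zero = refl
iter-multiple f {x} k per (suc c) =
  trans (sym (iter-+ f (suc k) (c * suc k) x)) (trans (cong (iter f (suc k)) (iter-multiple f k per c)) per)

iter-return : ∀ (f : A → A) {x} k → iter f (suc k) x ≡ x → ∀ t → iter f (t * k) (iter f t x) ≡ x
iter-return f {x} k per t =
  trans (iter-+ f (t * k) t x)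
        (trans (cong (λ n → iter f n x) (trans (+-comm (t * k) t) (sym (*-suc t k))))
               (iter-multiple f k per t))

iter-rot-++ : ∀ (xs ys : List A) → iter rot (length xs) (xs ++ ys) ≡ ys ++ xs
iter-rot-++ [] ys = sym (++-identityʳ ys)
iter-rot-++ (x ∷ xs) ys = begin
  iter rot (suc (length xs)) (x ∷ xs ++ ys)   ≡⟨ iter-suc-inner rot (length xs) (x ∷ xs ++ ys) ⟨
  iter rot (length xs) ((xs ++ ys) ++ [ x ])  ≡⟨ cong (iter rot (length xs)) (++-assoc xs ys [ x ]) ⟩
  iter rot (length xs) (xs ++ ys ++ [ x ])    ≡⟨ iter-rot-++ xs (ys ++ [ x ]) ⟩
  (ys ++ [ x ]) ++ xs                         ≡⟨ ++-assoc ys [ x ] xs ⟩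
  ys ++ x ∷ xs                                ∎
  where open ≡-Reasoning

iter-rot-length : ∀ (xs : List A) → iter rot (length xs) xs ≡ xs
iter-rot-length xs = trans (cong (iter rot (length xs)) (sym (++-identityʳ xs))) (iter-rot-++ xs [])

head-iter-rot : ∀ t (xs : List A) → t < length xs → head (iter rot t xs) ≡ head (drop t xs)
head-iter-rot t xs t< with drop-< t xs t<
... | y , ys , dropped = begin
  head (iter rot t xs)
    ≡⟨ cong (head ∘ iter rot t) (take++drop≡id t xs) ⟨
  head (iter rot t (take t xs ++ drop t xs))
    ≡⟨ cong (λ n → head (iter rot n (take t xs ++ drop t xs))) |take| ⟨
  head (iter rot (length (take t xs)) (take t xs ++ drop t xs))
    ≡⟨ cong head (iter-rot-++ (take t xs) (drop t xs)) ⟩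
  head (drop t xs ++ take t xs)
    ≡⟨ cong (λ zs → head (zs ++ take t xs)) dropped ⟩
  just y
    ≡⟨ cong head dropped ⟨
  head (drop t xs) ∎
  where
  open ≡-Reasoning
  |take| : length (take t xs) ≡ t
  |take| = trans (length-take t xs) (m≤n⇒m⊓n≡m (<⇒≤ t<))

head-drop-injective : ∀ {xs : List A} {a b} → Unique xs → a < b → b < length xs →
  head (drop a xs) ≢ head (drop b xs)
head-drop-injective {xs = x ∷ xs} {zero} {suc b} (x∉xs ∷ _) _ (s≤s b<) eq with drop-< b xs b<
... | y , ys , dropped =
  All.head (subst (All (x ≢_)) dropped (All.drop⁺ b x∉xs)) (just-injective (trans eq (cong head dropped)))
head-drop-injective {xs = x ∷ xs} {suc a} {suc b} (_ ∷ xs-unique) (s≤s a<b) (s≤s b<) =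
  head-drop-injective xs-unique a<b b<

Orbit : (A → A) → A → ℕ → Set
Orbit f x r = ∃ λ O → Unique O × length O ≡ r × (∀ y → y ∈ O ⇔ ∃ λ u → iter f u x ≡ y)

orbit-of-period : ∀ {A : Set} (f : A → A) x r → 0 < r → iter f r x ≡ x →
  (∀ {a b} → a < b → b < r → iter f a x ≢ iter f b x) → Orbit f x r
orbit-of-period {A} f x r 0<r back distinct =
  applyUpTo orbit r , applyUpTo⁺₁ orbit r distinct , length-applyUpTo orbit r , λ y → mk⇔ to from
  where
  orbit : ℕ → A
  orbit u = iter f u x
  reduce : ∀ u → ∃ λ v → v < r × orbit u ≡ orbit v
  reduce zero = 0 , 0<r , refl
  reduce (suc u) with reduce u
  ... | v , v<r , u≡v with suc v ≟ r
  ...   | yes refl = 0 , 0<r , trans (cong f u≡v) back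
  ...   | no v+1≢r = suc v , ≤∧≢⇒< v<r v+1≢r , cong f u≡v
  to : ∀ {y} → y ∈ applyUpTo orbit r → ∃ λ u → orbit u ≡ y
  to y∈ with ∈-applyUpTo⁻ orbit y∈
  ... | u , _ , y≡ = u , sym y≡
  from : ∀ {y} → (∃ λ u → orbit u ≡ y) → y ∈ applyUpTo orbit r
  from (u , refl) with reduce u
  ... | v , v<r , u≡v = subst (_∈ applyUpTo orbit r) (sym u≡v) (∈-applyUpTo⁺ orbit v<r)

Orbit-cong : ∀ {f g : A → A} {x r} → (∀ y → f y ≡ g y) → Orbit g x r → Orbit f x r
Orbit-cong {f = f} {g} {x} f≗g (O , O-unique , |O| , O≡orbit) = O , O-unique , |O| , λ y → mk⇔
  (λ y∈O → let (u , u≡y) = Equivalence.to (O≡orbit y) y∈O in u , trans (iter-cong f≗g u x) u≡y)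
  (λ (u , u≡y) → Equivalence.from (O≡orbit y) (u , trans (sym (iter-cong f≗g u x)) u≡y))

-- The patterns 123 and 132

any-subseqs-∷ : ∀ (p : List ℕ → Bool) x xs →
  any p (subseqs (x ∷ xs)) ≡ any (p ∘ (x ∷_)) (subseqs xs) ∨ any p (subseqs xs)
any-subseqs-∷ p x xs =
  trans (any-++ p (map (x ∷_) (subseqs xs)) (subseqs xs))
        (cong (_∨ any p (subseqs xs)) (any-map p (x ∷_) (subseqs xs)))

any-subseqs-guarded : ∀ (p q : List ℕ → Bool) b x xs → (∀ s → p (x ∷ s) ≡ b ∧ q s) →
  any p (subseqs (x ∷ xs)) ≡ (b ∧ any q (subseqs xs)) ∨ any p (subseqs xs)
any-subseqs-guarded p q b x xs p≡ =
  trans (any-subseqs-∷ p x xs)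
        (cong (_∨ any p (subseqs xs)) (trans (any-cong p≡ (subseqs xs)) (any-const-∧ b q (subseqs xs))))

any-null-subseqs : ∀ xs → any null (subseqs xs) ≡ true
any-null-subseqs [] = refl
any-null-subseqs (x ∷ xs) =
  trans (any-subseqs-∷ null x xs) (trans (cong (b ∨_) (any-null-subseqs xs)) (∨-zeroʳ b))
  where
  b : Bool
  b = any (null ∘ (x ∷_)) (subseqs xs)

hasLarger₁ : ℕ → List ℕ → Bool
hasLarger₁ a [] = false
hasLarger₁ a (y ∷ ys) = (a <ᵇ y) ∨ hasLarger₁ a ys

hasLarger₂ : ℕ → List ℕ → Bool
hasLarger₂ a [] = false
hasLarger₂ a (y ∷ ys) = ((a <ᵇ y) ∧ hasLarger₁ a ys) ∨ hasLarger₂ a ys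

has123or132 : List ℕ → Bool
has123or132 [] = false
has123or132 (x ∷ xs) = hasLarger₂ x xs ∨ has123or132 xs

isLarger₁ : ℕ → List ℕ → Bool
isLarger₁ a (c ∷ []) = a <ᵇ c
isLarger₁ a _ = false

isLarger₂ : ℕ → List ℕ → Bool
isLarger₂ a (b ∷ c ∷ []) = (a <ᵇ b) ∧ (a <ᵇ c)
isLarger₂ a _ = false

is123or132 : List ℕ → Bool
is123or132 s = orderIso s (1 ∷ 2 ∷ 3 ∷ []) ∨ orderIso s (1 ∷ 3 ∷ 2 ∷ [])

isLarger₁-∷ : ∀ a c s → isLarger₁ a (c ∷ s) ≡ (a <ᵇ c) ∧ null s
isLarger₁-∷ a c [] = sym (∧-identityʳ _)
isLarger₁-∷ a c (_ ∷ _) = sym (∧-zeroʳ _)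

isLarger₂-∷ : ∀ a b s → isLarger₂ a (b ∷ s) ≡ (a <ᵇ b) ∧ isLarger₁ a s
isLarger₂-∷ a b [] = sym (∧-zeroʳ _)
isLarger₂-∷ a b (_ ∷ []) = refl
isLarger₂-∷ a b (_ ∷ _ ∷ _) = sym (∧-zeroʳ _)

is123or132-∷ : ∀ a s → is123or132 (a ∷ s) ≡ isLarger₂ a s
is123or132-∷ a [] = refl
is123or132-∷ a (b ∷ []) = refl
is123or132-∷ a (b ∷ c ∷ []) with a <ᵇ b | a <ᵇ c | b <ᵇ c
... | true  | true  | true  = refl
... | true  | true  | false = refl
... | true  | false | true  = refl
... | true  | false | false = refl
... | false | true  | true  = refl
... | false | true  | false = refl
... | false | false | true  = refl
... | false | false | false = refl
is123or132-∷ a (b ∷ c ∷ d ∷ s) = refl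

any-isLarger₁-subseqs : ∀ a xs → any (isLarger₁ a) (subseqs xs) ≡ hasLarger₁ a xs
any-isLarger₁-subseqs a [] = refl
any-isLarger₁-subseqs a (x ∷ xs) = begin
  any (isLarger₁ a) (subseqs (x ∷ xs))
    ≡⟨ any-subseqs-guarded (isLarger₁ a) null (a <ᵇ x) x xs (isLarger₁-∷ a x) ⟩
  ((a <ᵇ x) ∧ any null (subseqs xs)) ∨ any (isLarger₁ a) (subseqs xs)
    ≡⟨ cong₂ (λ b c → ((a <ᵇ x) ∧ b) ∨ c) (any-null-subseqs xs) (any-isLarger₁-subseqs a xs) ⟩
  ((a <ᵇ x) ∧ true) ∨ hasLarger₁ a xs
    ≡⟨ cong (_∨ hasLarger₁ a xs) (∧-identityʳ (a <ᵇ x)) ⟩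
  hasLarger₁ a (x ∷ xs) ∎
  where open ≡-Reasoning

any-isLarger₂-subseqs : ∀ a xs → any (isLarger₂ a) (subseqs xs) ≡ hasLarger₂ a xs
any-isLarger₂-subseqs a [] = refl
any-isLarger₂-subseqs a (x ∷ xs) =
  trans (any-subseqs-guarded (isLarger₂ a) (isLarger₁ a) (a <ᵇ x) x xs (isLarger₂-∷ a x))
        (cong₂ (λ b c → ((a <ᵇ x) ∧ b) ∨ c) (any-isLarger₁-subseqs a xs) (any-isLarger₂-subseqs a xs))

any-is123or132-subseqs : ∀ xs → any is123or132 (subseqs xs) ≡ has123or132 xs
any-is123or132-subseqs [] = refl
any-is123or132-subseqs (x ∷ xs) =
  trans (any-subseqs-∷ is123or132 x xs)
        (cong₂ _∨_ (trans (any-cong (is123or132-∷ x) (subseqs xs)) (any-isLarger₂-subseqs x xs))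
                   (any-is123or132-subseqs xs))

avoidsAll-123-132 : ∀ σ → avoidsAll T123-132 σ ≡ not (has123or132 σ)
avoidsAll-123-132 σ = trans (deMorgan (contains σ (1 ∷ 2 ∷ 3 ∷ [])) (contains σ (1 ∷ 3 ∷ 2 ∷ [])))
  (cong not (trans (sym (any-∨ _ _ (subseqs σ))) (any-is123or132-subseqs σ)))
  where
  deMorgan : ∀ a b → not a ∧ (not b ∧ true) ≡ not (a ∨ b)
  deMorgan true b = refl
  deMorgan false true = refl
  deMorgan false false = refl

-- The stack machine

canPush : ℕ → List ℕ → Bool
canPush x st = not (has123or132 (x ∷ st))

push : ℕ → List ℕ → List ℕ → List ℕ × List ℕ
push x [] out = x ∷ [] , out
push x (y ∷ st) out =
  if canPush x (y ∷ st) then (x ∷ y ∷ st , out) else push x st (out ++ [ y ])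

pushAll : List ℕ → List ℕ → List ℕ → List ℕ × List ℕ
pushAll [] st out = st , out
pushAll (x ∷ xs) st out = uncurry (pushAll xs) (push x st out)

finish : List ℕ × List ℕ → List ℕ
finish (st , out) = out ++ st

stackSort : List ℕ → List ℕ
stackSort π = finish (pushAll π [] [])

double-suc : ∀ a b → suc a + suc a + b ≡ suc (a + a + suc b)
double-suc a b = trans (cong (λ c → suc (c + b)) (+-suc a a)) (cong suc (sym (+-suc (a + a) b)))

fuel : List ℕ → List ℕ → ℕ
fuel inp st = length inp + length inp + length st

run≡finish-pushAll : ∀ k inp st out → fuel inp st ≤ k →
  run T123-132 k inp st out ≡ finish (pushAll inp st out)
run≡finish-pushAll zero [] [] out _ = sym (++-identityʳ out)
run≡finish-pushAll (suc k) [] [] out _ = sym (++-identityʳ out)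
run≡finish-pushAll (suc k) (x ∷ inp) [] out h =
  run≡finish-pushAll k inp [ x ] out (≤-pred (subst (_≤ suc k) (double-suc (length inp) 0) h))
run≡finish-pushAll (suc k) [] (y ∷ st) out (s≤s h) =
  trans (run≡finish-pushAll k [] st (out ++ [ y ]) h) (++-assoc out [ y ] st)
run≡finish-pushAll (suc k) (x ∷ inp) (y ∷ st) out h
  rewrite avoidsAll-123-132 (x ∷ y ∷ st) with canPush x (y ∷ st)
... | true = run≡finish-pushAll k inp (x ∷ y ∷ st) out
               (≤-pred (subst (_≤ suc k) (double-suc (length inp) (suc (length st))) h))
... | false = run≡finish-pushAll k (x ∷ inp) st (out ++ [ y ])
               (≤-pred (subst (_≤ suc k) (+-suc (suc (length inp) + suc (length inp)) (length st)) h))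

sT≡stackSort : ∀ π → sT T123-132 π ≡ stackSort π
sT≡stackSort π = run≡finish-pushAll (2 * length π) π [] [] (≤-reflexive fuel≡)
  where
  fuel≡ : fuel π [] ≡ 2 * length π
  fuel≡ = trans (+-identityʳ _) (cong (length π +_) (sym (+-identityʳ (length π))))

<ᵇ-true : ∀ {m n} → m < n → (m <ᵇ n) ≡ true
<ᵇ-true m<n = Equivalence.to T-≡ (<⇒<ᵇ m<n)

<ᵇ-false : ∀ {m n} → n < m → (m <ᵇ n) ≡ false
<ᵇ-false {m} {n} n<m with m <ᵇ n in eq
... | false = refl
... | true = ⊥-elim (<-asym n<m (<ᵇ⇒< m n (subst T (sym eq) _)))

hasLarger₂-single : ∀ x p → hasLarger₂ x [ p ] ≡ false
hasLarger₂-single x p with x <ᵇ p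
... | true = refl
... | false = refl

hasLarger₁-∷ʳ : ∀ {x p} zs → x < p → hasLarger₁ x (zs ++ [ p ]) ≡ true
hasLarger₁-∷ʳ [] x<p rewrite <ᵇ-true x<p = refl
hasLarger₁-∷ʳ (z ∷ zs) x<p = trans (cong (_ ∨_) (hasLarger₁-∷ʳ zs x<p)) (∨-zeroʳ _)

canPush-single : ∀ x p → canPush x [ p ] ≡ true
canPush-single x p rewrite hasLarger₂-single x p = refl

canPush-pair : ∀ {x m p} → m < x → m < p → canPush x (m ∷ p ∷ []) ≡ true
canPush-pair {x} {m} {p} m<x m<p
  rewrite <ᵇ-false {x} m<x | hasLarger₂-single x p | hasLarger₂-single m p = refl

canPush-blocked : ∀ {x z p} zs → x < z → x < p → canPush x (z ∷ zs ++ [ p ]) ≡ false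
canPush-blocked zs x<z x<p rewrite <ᵇ-true x<z | hasLarger₁-∷ʳ zs x<p = refl

push-accept : ∀ {x y st out} → canPush x (y ∷ st) ≡ true →
  push x (y ∷ st) out ≡ (x ∷ y ∷ st , out)
push-accept accepted rewrite accepted = refl

push-reject : ∀ {x y st out} → canPush x (y ∷ st) ≡ false →
  push x (y ∷ st) out ≡ push x st (out ++ [ y ])
push-reject rejected rewrite rejected = refl

push-keeps-base : ∀ (P : ℕ → Set) {x b bs} zs out → canPush x (b ∷ bs) ≡ true → P x → All P zs →
  ∃₂ λ zs′ out′ → push x (zs ++ b ∷ bs) out ≡ (zs′ ++ b ∷ bs , out′) × All P zs′
push-keeps-base P {x} [] out ok px _ = x ∷ [] , out , push-accept ok , px ∷ []
push-keeps-base P {x} {b} {bs} (z ∷ zs) out ok px (pz ∷ pzs) with canPush x (z ∷ zs ++ b ∷ bs)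
... | true = x ∷ z ∷ zs , out , refl , px ∷ pz ∷ pzs
... | false = push-keeps-base P zs (out ++ [ z ]) ok px pzs

pushAll-keeps-base : ∀ (P : ℕ → Set) {b bs} inp zs out →
  All (λ x → canPush x (b ∷ bs) ≡ true) inp → All P inp → All P zs →
  ∃₂ λ zs′ out′ → pushAll inp (zs ++ b ∷ bs) out ≡ (zs′ ++ b ∷ bs , out′) × All P zs′
pushAll-keeps-base P [] zs out _ _ pzs = zs , out , refl , pzs
pushAll-keeps-base P {b} {bs} (x ∷ inp) zs out (ok ∷ oks) (px ∷ pinp) pzs
  with push x (zs ++ b ∷ bs) out | push-keeps-base P {x} {b} {bs} zs out ok px pzs
... | _ | zs₁ , out₁ , refl , pzs₁ = pushAll-keeps-base P inp zs₁ out₁ oks pinp pzs₁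

push-below-all : ∀ {x p} zs out → All (x <_) zs → x < p →
  push x (zs ++ [ p ]) out ≡ (x ∷ p ∷ [] , out ++ zs)
push-below-all {x} {p} [] out _ _ =
  trans (push-accept (canPush-single x p)) (cong (_ ,_) (sym (++-identityʳ out)))
push-below-all {x} {p} (z ∷ zs) out (x<z ∷ x<zs) x<p =
  trans (push-reject {x} {z} {zs ++ [ p ]} (canPush-blocked zs x<z x<p))
        (trans (push-below-all zs (out ++ [ z ]) x<zs x<p) (cong (_ ,_) (++-assoc out [ z ] zs)))

pushAll-onto-single : ∀ (P : ℕ → Set) p w → All P w →
  ∃₂ λ zs out → pushAll w [ p ] [] ≡ (zs ++ [ p ] , out) × All P zs
pushAll-onto-single P p w pw =
  pushAll-keeps-base P w [] [] (All.universal (λ x → canPush-single x p) w) pw []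

pushAll-++ : ∀ xs ys st out → pushAll (xs ++ ys) st out ≡ uncurry (pushAll ys) (pushAll xs st out)
pushAll-++ [] ys st out = refl
pushAll-++ (x ∷ xs) ys st out = pushAll-++ xs ys _ _

push-↭ : ∀ x st out → finish (push x st out) ↭ out ++ x ∷ st
push-↭ x [] out = ↭-refl
push-↭ x (y ∷ st) out with canPush x (y ∷ st)
... | true = ↭-refl
... | false = ↭-trans (push-↭ x st (out ++ [ y ])) (begin
  (out ++ [ y ]) ++ x ∷ st  ≡⟨ ++-assoc out [ y ] (x ∷ st) ⟩
  out ++ y ∷ x ∷ st         ↭⟨ ++⁺ˡ out (swap y x ↭-refl) ⟩
  out ++ x ∷ y ∷ st         ∎)
  where open PermutationReasoning

pushAll-↭ : ∀ inp st out → finish (pushAll inp st out) ↭ out ++ st ++ inp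
pushAll-↭ [] st out = ↭-reflexive (cong (out ++_) (sym (++-identityʳ st)))
pushAll-↭ (x ∷ inp) st out = begin
  finish (pushAll inp (proj₁ c) (proj₂ c))  ↭⟨ pushAll-↭ inp (proj₁ c) (proj₂ c) ⟩
  proj₂ c ++ proj₁ c ++ inp                 ≡⟨ ++-assoc (proj₂ c) (proj₁ c) inp ⟨
  finish c ++ inp                           ↭⟨ ++⁺ʳ inp (push-↭ x st out) ⟩
  (out ++ x ∷ st) ++ inp                    ≡⟨ ++-assoc out (x ∷ st) inp ⟩
  out ++ x ∷ st ++ inp                      ↭⟨ ++⁺ˡ out (shift x st inp) ⟨
  out ++ st ++ x ∷ inp                      ∎
  where
  open PermutationReasoning
  c : List ℕ × List ℕ
  c = push x st out

stackSort-↭ : ∀ w → stackSort w ↭ w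
stackSort-↭ w = pushAll-↭ w [] []

front : ℕ → List ℕ → List ℕ
front p w = take (length w) (stackSort (p ∷ w))

stackSort-keeps-first-last : ∀ p w → ∃ λ xs → stackSort (p ∷ w) ≡ xs ++ [ p ]
stackSort-keeps-first-last p w with pushAll-onto-single (λ _ → ⊤) p w (All.universal _ w)
... | zs , out , pushed , _ = out ++ zs , trans (cong finish pushed) (sym (++-assoc out zs [ p ]))

stackSort-∷ : ∀ p w → stackSort (p ∷ w) ≡ front p w ++ [ p ]
stackSort-∷ p w with stackSort-keeps-first-last p w
... | xs , sorted = trans sorted (cong (_++ [ p ]) (sym front≡xs))
  where
  |xs| : length xs ≡ length w
  |xs| = length-∷ʳ-↭ xs (↭-trans (↭-reflexive (sym sorted)) (stackSort-↭ (p ∷ w)))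
  front≡xs : front p w ≡ xs
  front≡xs = trans (cong (take (length w)) sorted)
    (subst (λ n → take n (xs ++ [ p ]) ≡ xs) |xs| (take-length-++ xs [ p ]))

length-front : ∀ p w → length (front p w) ≡ length w
length-front p w =
  length-∷ʳ-↭ (front p w) (↭-trans (↭-reflexive (sym (stackSort-∷ p w))) (stackSort-↭ (p ∷ w)))

stackSort-pair : ∀ p q → stackSort (p ∷ q ∷ []) ≡ q ∷ p ∷ []
stackSort-pair p q rewrite push-accept {q} {p} {[]} {[]} (canPush-single q p) = refl

front-++-↭ : ∀ p w g → front p w ++ g ++ [ p ] ↭ p ∷ w ++ g
front-++-↭ p w g = begin
  front p w ++ g ++ [ p ]    ↭⟨ ++⁺ˡ (front p w) (++-comm g [ p ]) ⟩
  front p w ++ [ p ] ++ g    ≡⟨ ++-assoc (front p w) [ p ] g ⟨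
  (front p w ++ [ p ]) ++ g  ≡⟨ cong (_++ g) (stackSort-∷ p w) ⟨
  stackSort (p ∷ w) ++ g     ↭⟨ ++⁺ʳ g (stackSort-↭ (p ∷ w)) ⟩
  p ∷ w ++ g                 ∎
  where open PermutationReasoning

stackSort-min-inside : ∀ {m p} u v → All (m <_) (p ∷ u) → All (m <_) v →
  ∃ λ xs → stackSort (p ∷ u ++ m ∷ v) ≡ xs ++ m ∷ p ∷ []
stackSort-min-inside {m} {p} u v (m<p ∷ m<u) m<v
  with pushAll-onto-single (m <_) p u m<u
... | zs , out , pushed , m<zs
  with pushAll-keeps-base (λ _ → ⊤) {m} {[ p ]} v [] (out ++ zs)
         (All.map (λ m<x → canPush-pair m<x m<p) m<v) (All.universal _ v) []
... | zs₂ , out₂ , pushed₂ , _ = out₂ ++ zs₂ , (begin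
  finish (pushAll (u ++ m ∷ v) [ p ] [])
    ≡⟨ cong finish (pushAll-++ u (m ∷ v) [ p ] []) ⟩
  finish (uncurry (pushAll (m ∷ v)) (pushAll u [ p ] []))
    ≡⟨ cong (finish ∘ uncurry (pushAll (m ∷ v))) pushed ⟩
  finish (uncurry (pushAll v) (push m (zs ++ [ p ]) out))
    ≡⟨ cong (finish ∘ uncurry (pushAll v)) (push-below-all zs out m<zs m<p) ⟩
  finish (pushAll v (m ∷ p ∷ []) (out ++ zs))
    ≡⟨ cong finish pushed₂ ⟩
  out₂ ++ zs₂ ++ m ∷ p ∷ []
    ≡⟨ ++-assoc out₂ zs₂ _ ⟨
  (out₂ ++ zs₂) ++ m ∷ p ∷ [] ∎)
  where open ≡-Reasoning

front-min : ∀ {m p} u v → All (m <_) (p ∷ u) → All (m <_) v →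
  ∃ λ xs → front p (u ++ m ∷ v) ≡ xs ++ [ m ] × xs ++ [ p ] ↭ p ∷ u ++ v
front-min {m} {p} u v m<pu m<v with stackSort-min-inside u v m<pu m<v
... | xs , sorted = xs , front≡ , drop-∷ (begin
  m ∷ xs ++ [ p ]              ↭⟨ shift m xs [ p ] ⟨
  xs ++ m ∷ p ∷ []             ≡⟨ sorted ⟨
  stackSort (p ∷ u ++ m ∷ v)   ↭⟨ stackSort-↭ (p ∷ u ++ m ∷ v) ⟩
  p ∷ u ++ m ∷ v               ↭⟨ shift m (p ∷ u) v ⟩
  m ∷ p ∷ u ++ v               ∎)
  where
  open PermutationReasoning
  front≡ : front p (u ++ m ∷ v) ≡ xs ++ [ m ]
  front≡ = ∷ʳ-injectiveˡ (front p (u ++ m ∷ v)) (xs ++ [ m ])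
    (trans (sym (stackSort-∷ p (u ++ m ∷ v))) (trans sorted (sym (++-assoc xs [ m ] [ p ]))))

weave : ℕ → List ℕ → List ℕ
weave zero _ = []
weave (suc i) [] = []
weave (suc i) (h ∷ g) = suc i ∷ h ∷ weave i g

-- the order in which stackSort emits weave i g when p lies at the bottom of the stack
weave′ : ℕ → List ℕ → ℕ → List ℕ
weave′ zero _ p = [ p ]
weave′ (suc i) [] p = [ p ]
weave′ (suc i) (h ∷ g) p = h ∷ suc i ∷ weave′ i g p

length-weave : ∀ i {g} → length g ≡ i → length (weave i g) ≡ i + i
length-weave zero _ = refl
length-weave (suc i) {h ∷ g} |h∷g| =
  cong suc (trans (cong suc (length-weave i (suc-injective |h∷g|))) (sym (+-suc i i)))

weave-∷ʳ : ∀ i {g p} → length g ≡ i → weave (suc i) (g ++ [ p ]) ≡ suc i ∷ weave′ i g p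
weave-∷ʳ zero {[]} _ = refl
weave-∷ʳ (suc i) {h ∷ g} |h∷g| = cong (λ r → suc (suc i) ∷ h ∷ r) (weave-∷ʳ i (suc-injective |h∷g|))

weave′-split : ∀ i {g p} → length g ≡ i →
  weave′ i g p ≡ take 1 (g ++ [ p ]) ++ weave i (drop 1 (g ++ [ p ]))
weave′-split zero {[]} _ = refl
weave′-split (suc i) {h ∷ g} |h∷g| = cong (h ∷_) (sym (weave-∷ʳ i (suc-injective |h∷g|)))

pushAll-weave : ∀ i {g p} zs out → length g ≡ i → All (i <_) g → All (i <_) zs → i < p →
  finish (pushAll (weave i g) (zs ++ [ p ]) out) ≡ out ++ zs ++ weave′ i g p
pushAll-weave zero zs out _ _ _ _ = refl
pushAll-weave (suc i) {h ∷ g} {p} zs out |h∷g| (i<h ∷ i<g) i<zs i<p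
  rewrite push-below-all zs out i<zs i<p
        | push-accept {h} {suc i} {[ p ]} {out ++ zs} (canPush-pair i<h i<p)
        | pushAll-weave i {g} {p} (h ∷ suc i ∷ []) (out ++ zs) (suc-injective |h∷g|)
            (All.map (<-trans (n<1+n i)) i<g) (<-trans (n<1+n i) i<h ∷ n<1+n i ∷ [])
            (<-trans (n<1+n i) i<p)
  = ++-assoc out zs _

stackSort-weave : ∀ i {p w g} → All (i <_) (p ∷ w) → All (i <_) g → length g ≡ i →
  stackSort (p ∷ w ++ weave i g) ≡ front p w ++ weave′ i g p
stackSort-weave i {p} {w} {g} (i<p ∷ i<w) i<g |g|
  with pushAll-onto-single (i <_) p w i<w
... | zs , out , pushed , i<zs = begin
  finish (pushAll (w ++ weave i g) [ p ] [])
    ≡⟨ cong finish (pushAll-++ w (weave i g) [ p ] []) ⟩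
  finish (uncurry (pushAll (weave i g)) (pushAll w [ p ] []))
    ≡⟨ cong (finish ∘ uncurry (pushAll (weave i g))) pushed ⟩
  finish (pushAll (weave i g) (zs ++ [ p ]) out)
    ≡⟨ pushAll-weave i zs out |g| i<g i<zs i<p ⟩
  out ++ zs ++ weave′ i g p
    ≡⟨ ++-assoc out zs _ ⟨
  (out ++ zs) ++ weave′ i g p
    ≡⟨ cong (_++ weave′ i g p) front≡ ⟨
  front p w ++ weave′ i g p ∎
  where
  open ≡-Reasoning
  front≡ : front p w ≡ out ++ zs
  front≡ = ∷ʳ-injectiveˡ (front p w) (out ++ zs)
    (trans (sym (stackSort-∷ p w)) (trans (cong finish pushed) (sym (++-assoc out zs [ p ]))))

-- Shapes

above : ℕ → ℕ → List ℕ
above a zero = []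
above a (suc k) = suc a ∷ above (suc a) k

above-> : ∀ a k → All (a <_) (above a k)
above-> a zero = []
above-> a (suc k) = n<1+n a ∷ All.map (<-trans (n<1+n a)) (above-> (suc a) k)

above-unique : ∀ a k → Unique (above a k)
above-unique a zero = []
above-unique a (suc k) = All.map <⇒≢ (above-> (suc a) k) ∷ above-unique (suc a) k

above-drop-min : ∀ {i R} l → suc i ∷ R ↭ above i l →
  ∃ λ l′ → R ↭ above (suc i) l′ × All (suc i <_) R
above-drop-min zero min∷R↭ with ↭-length min∷R↭
... | ()
above-drop-min {i} (suc l) min∷R↭ =
  l , drop-∷ min∷R↭ , All-resp-↭ (↭-sym (drop-∷ min∷R↭)) (above-> (suc i) l)

map-suc-applyUpTo : ∀ (f : ℕ → ℕ) a n → (∀ j → f j ≡ a + j) → map suc (applyUpTo f n) ≡ above a n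
map-suc-applyUpTo f a zero _ = refl
map-suc-applyUpTo f a (suc n) f≡ = cong₂ _∷_ (cong suc (trans (f≡ 0) (+-identityʳ a)))
  (map-suc-applyUpTo (f ∘ suc) (suc a) n (λ j → trans (f≡ (suc j)) (+-suc a j)))

oneTo≡above : ∀ n → oneTo n ≡ above 0 n
oneTo≡above n = map-suc-applyUpTo (λ j → j) 0 n (λ _ → refl)

record Shape (i k : ℕ) (π : List ℕ) : Set where
  constructor shape
  field
    P g : List ℕ
    l : ℕ
    |P| : length P ≡ suc k
    |g| : length g ≡ i
    core↭ : P ++ g ↭ above i l
    π≡ : π ≡ P ++ weave i g

core : ∀ {i k π} → Shape i k π → List ℕ
core s = Shape.P s ++ Shape.g s

core-large : ∀ {i k π} (s : Shape i k π) → All (i <_) (core s)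
core-large {i} s = All-resp-↭ (↭-sym (Shape.core↭ s)) (above-> i (Shape.l s))

core-unique : ∀ {i k π} (s : Shape i k π) → Unique (core s)
core-unique {i} s = Unique-resp-↭ (↭⇒↭ₛ (↭-sym (Shape.core↭ s))) (above-unique i (Shape.l s))

min∈core : ∀ {i k π} (s : Shape i k π) → suc i ∈ core s
min∈core (shape [] _ _ () _ _ _)
min∈core (shape (_ ∷ _) _ zero _ _ core↭ _) with ↭-length core↭
... | ()
min∈core (shape (_ ∷ _) _ (suc l) _ _ core↭ _) = ∈-resp-↭ (↭-sym core↭) (here refl)

length-π : ∀ {i k π} → Shape i k π → length π ≡ suc k + (i + i)
length-π (shape P g _ |P| |g| _ refl) = trans (length-++ P) (cong₂ _+_ |P| (length-weave _ |g|))

length-core : ∀ {i k π} (s : Shape i k π) → length (core s) ≡ suc k + i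
length-core (shape P g _ |P| |g| _ _) = trans (length-++ P) (cong₂ _+_ |P| |g|)

head-π : ∀ {i k π} (s : Shape i k π) → head π ≡ head (core s)
head-π (shape [] _ _ () _ _ _)
head-π (shape (p ∷ w) _ _ _ _ _ refl) = refl

core-determines-π : ∀ {i k π π′} (s : Shape i k π) (s′ : Shape i k π′) → core s ≡ core s′ → π ≡ π′
core-determines-π (shape P g _ |P| _ _ refl) (shape P′ g′ _ |P′| _ _ refl) eq
  with ++-cancel-length P P′ (trans |P| (sym |P′|)) eq
... | refl , refl = refl

next : ∀ {i k π} → Shape i k π → Shape i k (stackSort π)
next (shape [] _ _ () _ _ _)
next {i} {k} s@(shape (p ∷ w) g l |P| |g| core↭ refl) =
  shape (front p w ++ take 1 (g ++ [ p ])) (drop 1 (g ++ [ p ])) l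
        |P′| (trans (length-drop-1-∷ʳ g) |g|) core′↭ π′≡
  where
  core′≡ : (front p w ++ take 1 (g ++ [ p ])) ++ drop 1 (g ++ [ p ]) ≡ front p w ++ g ++ [ p ]
  core′≡ = trans (++-assoc (front p w) _ _) (cong (front p w ++_) (take++drop≡id 1 (g ++ [ p ])))
  |P′| : length (front p w ++ take 1 (g ++ [ p ])) ≡ suc k
  |P′| = trans (length-++ (front p w))
    (trans (cong₂ _+_ (trans (length-front p w) (suc-injective |P|)) (length-take-1-∷ʳ g)) (+-comm k 1))
  core′↭ : (front p w ++ take 1 (g ++ [ p ])) ++ drop 1 (g ++ [ p ]) ↭ above i l
  core′↭ = ↭-trans (↭-reflexive core′≡) (↭-trans (front-++-↭ p w g) core↭)
  π′≡ : stackSort (p ∷ w ++ weave i g) ≡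
        (front p w ++ take 1 (g ++ [ p ])) ++ weave i (drop 1 (g ++ [ p ]))
  π′≡ = trans (stackSort-weave i (++⁻ˡ (p ∷ w) (core-large s)) (++⁻ʳ (p ∷ w) (core-large s)) |g|)
    (trans (cong (front p w ++_) (weave′-split i |g|)) (sym (++-assoc (front p w) _ _)))

core-next : ∀ {i k π} (s : Shape i k π) → k ≤ 1 → core (next s) ≡ rot (core s)
core-next (shape [] _ _ () _ _ _) _
core-next (shape (p ∷ []) g _ refl _ _ refl) _ = take++drop≡id 1 (g ++ [ p ])
core-next (shape (p ∷ q ∷ []) g _ refl _ _ refl) _ =
  trans (++-assoc (front p [ q ]) _ _)
        (cong₂ _++_ (cong (take 1) (stackSort-pair p q)) (take++drop≡id 1 (g ++ [ p ])))
core-next (shape (p ∷ q ∷ r ∷ _) _ _ refl _ _ _) (s≤s ())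

iterate-next : ∀ {i k π} t → Shape i k π → Shape i k (iter stackSort t π)
iterate-next zero s = s
iterate-next (suc t) s = next (iterate-next t s)

core-iterate-next : ∀ {i k π} → k ≤ 1 → ∀ t (s : Shape i k π) →
  core (iterate-next t s) ≡ iter rot t (core s)
core-iterate-next k≤1 zero s = refl
core-iterate-next k≤1 (suc t) s =
  trans (core-next (iterate-next t s) k≤1) (cong rot (core-iterate-next k≤1 t s))

-- i + 1 flushes the stack down to p, so it is emitted just before p and starts the woven part.
absorb-min : ∀ {i k π p} u v (s : Shape i (2 + k) π) → Shape.P s ≡ p ∷ u ++ suc i ∷ v →
  Shape (suc i) k (stackSort π)
absorb-min {i} {k} {p = p} u v s@(shape _ g l |P| |g| core↭ refl) refl
  with above-drop-min l min∷R↭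
  where
  min∷R↭ : suc i ∷ p ∷ u ++ v ++ g ↭ above i l
  min∷R↭ = ↭-trans (↭-sym (shift (suc i) (p ∷ u) (v ++ g)))
    (↭-trans (↭-reflexive (cong (p ∷_) (sym (++-assoc u (suc i ∷ v) g)))) core↭)
... | l′ , R↭ , m<R with front-min u v (++⁻ˡ (p ∷ u) m<R) (++⁻ˡ v (++⁻ʳ (p ∷ u) m<R))
... | xs , front≡ , xs↭ =
  shape xs (g ++ [ p ]) l′ |xs| (trans (length-∷ʳ g) (cong suc |g|)) core′↭ π′≡
  where
  open PermutationReasoning
  |xs| : length xs ≡ suc k
  |xs| = suc-injective (trans (sym (length-∷ʳ xs))
    (trans (cong length (sym front≡)) (trans (length-front p (u ++ suc i ∷ v)) (suc-injective |P|))))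
  core′↭ : xs ++ g ++ [ p ] ↭ above (suc i) l′
  core′↭ = begin
    xs ++ g ++ [ p ]    ↭⟨ ++⁺ˡ xs (++-comm g [ p ]) ⟩
    xs ++ [ p ] ++ g    ≡⟨ ++-assoc xs [ p ] g ⟨
    (xs ++ [ p ]) ++ g  ↭⟨ ++⁺ʳ g xs↭ ⟩
    (p ∷ u ++ v) ++ g   ≡⟨ cong (p ∷_) (++-assoc u v g) ⟩
    p ∷ u ++ v ++ g     ↭⟨ R↭ ⟩
    above (suc i) l′    ∎
  π′≡ : stackSort (p ∷ (u ++ suc i ∷ v) ++ weave i g) ≡ xs ++ weave (suc i) (g ++ [ p ])
  π′≡ = trans (stackSort-weave i (++⁻ˡ (p ∷ u ++ suc i ∷ v) (core-large s))
                                (++⁻ʳ (p ∷ u ++ suc i ∷ v) (core-large s)) |g|)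
    (trans (cong (_++ weave′ i g p) front≡)
    (trans (++-assoc xs [ suc i ] _) (cong (xs ++_) (sym (weave-∷ʳ i |g|)))))

absorb-last : ∀ {i k π} Q (s : Shape i (2 + k) π) → Shape.P s ≡ Q ++ [ suc i ] →
  Shape (suc i) k (stackSort π)
absorb-last [] (shape _ _ _ () _ _ _) refl
absorb-last (q ∷ u) s P≡ = absorb-min u [] s P≡

absorb-from-g : ∀ {i k π} g₁ {g₂} (s : Shape i (2 + k) π) → Shape.g s ≡ g₁ ++ suc i ∷ g₂ →
  ∃ λ t → Shape (suc i) k (iter stackSort t π)
absorb-from-g g₁ (shape [] _ _ () _ _ _) _
absorb-from-g [] s@(shape (p ∷ w) _ _ _ _ _ refl) refl = 2 , absorb-last (front p w) (next s) refl
absorb-from-g {i} {k} (h ∷ g₁) {g₂} s@(shape (p ∷ w) _ _ _ _ _ refl) refl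
  with absorb-from-g g₁ {g₂ ++ [ p ]} (next s) (++-assoc g₁ (suc i ∷ g₂) [ p ])
... | t , s′ = suc t , subst (Shape (suc i) k) (iter-suc-inner stackSort t _) s′

absorb-from-head : ∀ {i k π} w (s : Shape i (2 + k) π) → Shape.P s ≡ suc i ∷ w →
  ∃ λ t → Shape (suc i) k (iter stackSort t π)
absorb-from-head {i} w s@(shape _ [] _ _ _ _ refl) refl = 2 , absorb-last (front (suc i) w) (next s) refl
absorb-from-head {i} {k} w s@(shape _ (h ∷ g) _ _ _ _ refl) refl with absorb-from-g g (next s) refl
... | t , s′ = suc t , subst (Shape (suc i) k) (iter-suc-inner stackSort t _) s′

absorb : ∀ {i k π} → Shape i (2 + k) π → ∃ λ t → Shape (suc i) k (iter stackSort t π)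
absorb (shape [] _ _ () _ _ _)
absorb s@(shape (p ∷ w) g _ _ _ _ _) with ∈-++⁻ (p ∷ w) (min∈core s)
... | inj₁ (here refl) = absorb-from-head w s refl
... | inj₁ (there m∈w) with ∈-∃++ m∈w
...   | u , v , refl = 1 , absorb-min u v s refl
absorb s | inj₂ m∈g with ∈-∃++ m∈g
...   | g₁ , g₂ , g≡ = absorb-from-g g₁ s g≡

reach-short-prefix : ∀ k {i π} → Shape i k π →
  ∃ λ t → ∃ λ i′ → ∃ λ k′ → k′ ≤ 1 × Shape i′ k′ (iter stackSort t π)
reach-short-prefix zero s = 0 , _ , 0 , z≤n , s
reach-short-prefix (suc zero) s = 0 , _ , 1 , s≤s z≤n , s
reach-short-prefix (suc (suc k)) {π = π} s with absorb s
... | t₁ , s₁ with reach-short-prefix k s₁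
...   | t₂ , i′ , k′ , k′≤1 , s₂ =
  t₂ + t₁ , i′ , k′ , k′≤1 , subst (Shape i′ k′) (iter-+ stackSort t₂ t₁ π) s₂

initial-shape : ∀ {n π} → π ↭ above 0 n → 0 < n → ∃ λ k → Shape 0 k π
initial-shape {suc _} {[]} π↭ _ with ↭-length π↭
... | ()
initial-shape {n} {p ∷ w} π↭ _ =
  length w ,
  shape (p ∷ w) [] n refl refl (↭-trans (↭-reflexive (++-identityʳ _)) π↭) (sym (++-identityʳ _))

periodic-shape : ∀ {i k k′ π} → iter stackSort (suc k) π ≡ π → ∀ t →
  Shape i k′ (iter stackSort t π) → Shape i k′ π
periodic-shape {i} {k} {k′} per t s =
  subst (Shape i k′) (iter-return stackSort k per t) (iterate-next (t * k) s)

-- Orbits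

orbit-of-shape : ∀ {i k π} → k ≤ 1 → (s : Shape i k π) → Orbit stackSort π (length (core s))
orbit-of-shape {i} {k} {π} k≤1 s = orbit-of-period stackSort π r 0<r back distinct
  where
  r : ℕ
  r = length (core s)
  0<r : 0 < r
  0<r = subst (0 <_) (sym (length-core s)) (s≤s z≤n)
  back : iter stackSort r π ≡ π
  back = core-determines-π (iterate-next r s) s
    (trans (core-iterate-next k≤1 r s) (iter-rot-length (core s)))
  head-orbit : ∀ t → t < r → head (iter stackSort t π) ≡ head (drop t (core s))
  head-orbit t t<r = trans (head-π (iterate-next t s))
    (trans (cong head (core-iterate-next k≤1 t s)) (head-iter-rot t (core s) t<r))
  distinct : ∀ {a b} → a < b → b < r → iter stackSort a π ≢ iter stackSort b π
  distinct {a} {b} a<b b<r eq = head-drop-injective (core-unique s) a<b b<r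
    (trans (sym (head-orbit a (<-trans a<b b<r))) (trans (cong head eq) (head-orbit b b<r)))

⌈x+[i+i]/2⌉ : ∀ x i → ⌈ x + (i + i) /2⌉ ≡ ⌈ x /2⌉ + i
⌈x+[i+i]/2⌉ x zero = trans (cong ⌈_/2⌉ (+-identityʳ x)) (sym (+-identityʳ _))
⌈x+[i+i]/2⌉ x (suc i) = begin
  ⌈ x + (suc i + suc i) /2⌉    ≡⟨ cong ⌈_/2⌉ (+-suc x (i + suc i)) ⟩
  ⌈ suc (x + (i + suc i)) /2⌉  ≡⟨ cong (λ j → ⌈ suc (x + j) /2⌉) (+-suc i i) ⟩
  ⌈ suc (x + suc (i + i)) /2⌉  ≡⟨ cong (λ j → ⌈ suc j /2⌉) (+-suc x (i + i)) ⟩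
  suc ⌈ x + (i + i) /2⌉        ≡⟨ cong suc (⌈x+[i+i]/2⌉ x i) ⟩
  suc (⌈ x /2⌉ + i)            ≡⟨ +-suc ⌈ x /2⌉ i ⟨
  ⌈ x /2⌉ + suc i              ∎
  where open ≡-Reasoning

length-core≡⌈length-π+1/2⌉ : ∀ {i k π} → k ≤ 1 → (s : Shape i k π) →
  length (core s) ≡ ⌈ (length π + 1) /2⌉
length-core≡⌈length-π+1/2⌉ {i} {k} {π} k≤1 s = begin
  length (core s)                  ≡⟨ length-core s ⟩
  suc k + i                        ≡⟨ cong (_+ i) (⌈2+k/2⌉ k≤1) ⟨
  ⌈ 2 + k /2⌉ + i                  ≡⟨ ⌈x+[i+i]/2⌉ (2 + k) i ⟨
  ⌈ 2 + k + (i + i) /2⌉            ≡⟨ cong ⌈_/2⌉ (+-comm 1 (suc k + (i + i))) ⟩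
  ⌈ (suc k + (i + i)) + 1 /2⌉      ≡⟨ cong (λ n → ⌈ n + 1 /2⌉) (length-π s) ⟨
  ⌈ (length π + 1) /2⌉             ∎
  where
  open ≡-Reasoning
  ⌈2+k/2⌉ : ∀ {k} → k ≤ 1 → ⌈ 2 + k /2⌉ ≡ suc k
  ⌈2+k/2⌉ z≤n = refl
  ⌈2+k/2⌉ (s≤s z≤n) = refl

corollary4p1 : (n : ℕ) → n ≥ 1 → (π : List ℕ) → π ↭ oneTo n →
    (∃ λ k → k > 0 × iter (sT T123-132) k π ≡ π) →
    ∃ λ (O : List (List ℕ)) → Unique O × length O ≡ ⌈ (n + 1) /2⌉ ×
      ((σ : List ℕ) → σ ∈ O ⇔ (∃ λ i → iter (sT T123-132) i π ≡ σ))
corollary4p1 n n≥1 π π↭ (suc k , _ , per)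
  with initial-shape (subst (π ↭_) (oneTo≡above n) π↭) n≥1
... | k₀ , s₀ with reach-short-prefix k₀ s₀
... | t , i , k′ , k′≤1 , s₁ =
  subst (Orbit (sT T123-132) π) |orbit| (Orbit-cong sT≡stackSort (orbit-of-shape k′≤1 s))
  where
  s : Shape i k′ π
  s = periodic-shape {k = k} (trans (sym (iter-cong sT≡stackSort (suc k) π)) per) t s₁
  |orbit| : length (core s) ≡ ⌈ (n + 1) /2⌉
  |orbit| = trans (length-core≡⌈length-π+1/2⌉ k′≤1 s)
    (cong (λ m → ⌈ (m + 1) /2⌉) (trans (↭-length π↭) (trans (length-map suc (upTo n)) (length-upTo n))))
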